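{- Let $w\in S_n$ have a reduced word $\mathbf i=(i_1,\dots,i_\ell)$ whose commutation class is $C=C(\mathbf i)=\{\mathbf i\}$. Then the uniform vote tally $\rho=\mathbb 1_{\operatorname{Pre}(C)}$ has majority relation $\triangleleft_\rho$ equal to $<_u\cap<_v$, where $u=s_{i_1}s_{i_2}\cdots s_{i_{\lfloor\ell/2\rfloor}}$ and $v=s_{i_1}s_{i_2}\cdots s_{i_{\lceil\ell/2\rceil}}$. In particular, if $\ell$ is even then $\triangleleft_\rho$ is the linear order $<_u$ with $u=s_{i_1}\cdots s_{i_{\ell/2}}$, and if $\ell$ is odd then $\triangleleft_\rho$ is $<_u\cap<_v$ with $u=s_{i_1}\cdots s_{i_{(\ell-1)/2}}$ and $v=s_{i_1}\cdots s_{i_{(\ell+1)/2}}$.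
   Context: For $w=(w_1,\dots,w_n)\in S_n$, $<_w$ denotes the linear order $w_1<_w\cdots<_w w_n$ on $[n]$, and $\operatorname{Inv}(w)=\{(a,b):1\le a<b\le n,\ b<_w a\}$. Let $s_i$ be the adjacent transposition of $i,i+1$; $ws_i$ is obtained from $w$ by swapping the entries in positions $i,i+1$. A reduced word for $w$ is $(i_1,\dots,i_\ell)$ with $w=s_{i_1}\cdots s_{i_\ell}$, $\ell=|\operatorname{Inv}(w)|$. The commutation class $C(\mathbf i)$ is the set of words obtained from $\mathbf i$ by repeatedly swapping adjacent entries differing by at least $2$. $\operatorname{Pre}(C)$ is the set of all $s_{i'_1}\cdots s_{i'_m}$ ($0\le m\le\ell$) with $(i'_1,\dots,i'_m)$ a prefix of a word in $C$. The uniform vote tally $\mathbb 1_{\operatorname{Pre}(C)}$ is $1$ on $\operatorname{Pre}(C)$ and $0$ elsewhere on $S_n$. For a vote tally $\rho:S_n\to\mathbb N$, the majority relation is $a\triangleleft_\rho b$ iff $\sum_{w':\,a<_{w'}b}\rho(w')>\sum_{w':\,b<_{w'}a}\rho(w')$; relations are regarded as subsets of $[n]\times[n]$. -}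

module Defs where

open import Data.Nat using (ℕ; zero; suc; _+_; _≤_; _<_; _≟_)
open import Data.List using (List; []; _∷_; map; concatMap; foldl; take; length; filter; upTo; cartesianProduct)
open import Data.List.Membership.Propositional using (_∈_)
open import Data.List.Membership.DecPropositional _≟_ using (_∈?_)
open import Data.List.Relation.Binary.Permutation.Propositional using (_↭_)
open import Data.Product using (Σ; _×_; _,_; ∃)
open import Data.Sum using (_⊎_; inj₁; inj₂)
open import Relation.Nullary using (Dec; yes; no; ¬_)
open import Relation.Nullary.Decidable using (_×-dec_)
open import Relation.Binary.PropositionalEquality using (_≡_; refl)
open import Relation.Binary.Construct.Closure.ReflexiveTransitive using (Star)
open import Function using (flip)
open import Data.Nat.ListAction using (sum)

-- Permutations of [n] = {1,…,n} in one-line notation w = (w₁,…,wₙ), as lists.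

idPerm : ℕ → List ℕ
idPerm n = map suc (upTo n)

IsPerm : ℕ → List ℕ → Set
IsPerm n w = w ↭ idPerm n

-- An explicit enumeration of Sₙ (each permutation of the list exactly once)
insertions : ℕ → List ℕ → List (List ℕ)
insertions x []       = (x ∷ []) ∷ []
insertions x (y ∷ ys) = (x ∷ y ∷ ys) ∷ map (y ∷_) (insertions x ys)

perms : List ℕ → List (List ℕ)
perms []       = [] ∷ []
perms (x ∷ xs) = concatMap (insertions x) (perms xs)

Sym : ℕ → List (List ℕ)
Sym n = perms (idPerm n)

data Before : List ℕ → ℕ → ℕ → Set where
  here  : ∀ {a b xs} → b ∈ xs → Before (a ∷ xs) a b
  there : ∀ {x a b xs} → Before xs a b → Before (x ∷ xs) a b

before? : ∀ w a b → Dec (Before w a b)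
before? [] a b = no λ ()
before? (x ∷ xs) a b with before? xs a b
... | yes p = yes (there p)
... | no ¬p with x ≟ a | b ∈? xs
...   | yes refl | yes q = yes (here q)
...   | yes refl | no ¬q = no λ { (here q) → ¬q q ; (there p) → ¬p p }
...   | no x≢a   | _     = no λ { (here q) → x≢a refl ; (there p) → ¬p p }

-- w sᵢ : swap the entries in positions i, i+1 (1-based)
swapAt : ℕ → List ℕ → List ℕ
swapAt (suc zero)    (x ∷ y ∷ xs) = y ∷ x ∷ xs
swapAt (suc (suc k)) (x ∷ xs)     = x ∷ swapAt (suc k) xs
swapAt _             xs           = xs

-- s_{i₁} s_{i₂} ⋯ s_{iₘ} ∈ Sₙ  (= (((e s_{i₁}) s_{i₂}) ⋯ ) s_{iₘ})
prod : ℕ → List ℕ → List ℕ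
prod n word = foldl (flip swapAt) (idPerm n) word

Inv : ℕ → List ℕ → List (ℕ × ℕ)
Inv n w = filter (λ { (a , b) → (suc a Data.Nat.≤? b) ×-dec before? w b a })
                 (cartesianProduct (idPerm n) (idPerm n))

IsWord : ℕ → List ℕ → Set
IsWord n word = ∀ k → k ∈ word → 1 ≤ k × k < n

IsReducedWord : ℕ → List ℕ → List ℕ → Set
IsReducedWord n w word = IsWord n word × prod n word ≡ w × length word ≡ length (Inv n w)

data CommStep : List ℕ → List ℕ → Set where
  swap  : ∀ {x y xs} → (2 + y ≤ x ⊎ 2 + x ≤ y) → CommStep (x ∷ y ∷ xs) (y ∷ x ∷ xs)
  there : ∀ {z xs ys} → CommStep xs ys → CommStep (z ∷ xs) (z ∷ ys)

InClass : List ℕ → List ℕ → Set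
InClass i j = Star CommStep i j

InPre : ℕ → List ℕ → List ℕ → Set
InPre n i w = Σ (List ℕ) λ j → InClass i j × Σ ℕ λ m → m ≤ length i × prod n (take m j) ≡ w

IsUniformTally : ℕ → List ℕ → (List ℕ → ℕ) → Set
IsUniformTally n i ρ = ∀ w → IsPerm n w → (InPre n i w → ρ w ≡ 1) × (¬ InPre n i w → ρ w ≡ 0)

support : ℕ → (List ℕ → ℕ) → ℕ → ℕ → ℕ
support n ρ a b = sum (map ρ (filter (λ w → before? w a b) (Sym n)))

Majority : ℕ → (List ℕ → ℕ) → ℕ → ℕ → Set
Majority n ρ a b = support n ρ b a < support n ρ a b

-- Write u_m = s_{i₁}⋯s_{iₘ}. A step u_m ↦ u_{m+1} changes the inversion number by at most
-- one, and it rises from 0 to ℓ, so inv(u_m) = m for every m ≤ ℓ: each step creates an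
-- inversion and none is ever undone, and u_0, …, u_ℓ are distinct. Since C = {i}, the
-- tally is the indicator of {u_0, …, u_ℓ}. For a ≠ b the set of m with a <_{u_m} b is
-- therefore an initial segment of [0, ℓ] (if a < b) or a final one (if b < a), and it holds
-- a majority of the ℓ + 1 votes exactly when it contains both ⌊ℓ/2⌋ and ⌈ℓ/2⌉.

module Submission where

open import Defs
open import Data.Nat using (ℕ; zero; suc; _+_; _*_; _∸_; _≤_; _<_; _≟_; z≤n; s≤s; ⌊_/2⌋; ⌈_/2⌉)
open import Data.Nat.Properties
open import Data.Nat.ListAction using (sum)
open import Data.Nat.ListAction.Properties using (sum-↭; sum-++)
open import Data.List using (List; []; _∷_; _++_; map; concatMap; foldl; take; length; filter; upTo; applyDownFrom; cartesianProduct)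
open import Data.List.Properties using (∷-injectiveˡ; ∷-injectiveʳ; ≡-dec; filter-++; length-filter; map-++; take-all; filter-none; length-map; length-upTo; length-applyDownFrom)
open import Data.List.Membership.Propositional using (_∈_; _∉_; find; lose)
open import Data.List.Membership.Propositional.Properties
open import Data.List.Membership.Propositional.Properties.WithK using (unique∧set⇒bag)
open import Data.List.Relation.Binary.BagAndSetEquality using (∼bag⇒↭)
open import Data.List.Relation.Unary.Any using (here; there)
open import Data.List.Relation.Unary.All as All using ([]; _∷_)
open import Data.List.Relation.Unary.AllPairs as AllPairs using (AllPairs; []; _∷_)
import Data.List.Relation.Unary.AllPairs.Properties as AllPairs
open import Data.List.Relation.Unary.Unique.Propositional using (Unique)
import Data.List.Relation.Unary.Unique.Propositional.Properties as Unique
open import Data.List.Relation.Binary.Permutation.Propositional using (_↭_; refl; prep; swap; ↭-trans; ↭-sym; ↭⇒↭ₛ)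
open import Data.List.Relation.Binary.Permutation.Propositional.Properties using (∈-resp-↭; ↭-length; ↭-empty-inv; shift; drop-∷; ++⁺ˡ)
import Data.List.Relation.Binary.Permutation.Propositional.Properties as ↭
import Data.List.Relation.Binary.Permutation.Setoid.Properties as ↭ₛ
open import Data.Product using (∃; _×_; _,_; proj₁; proj₂)
import Data.Product.Properties as Product
open import Data.Sum using (_⊎_; inj₁; inj₂)
open import Data.Empty using (⊥-elim)
open import Function using (flip; _∘_)
open import Function.Bundles using (_⇔_; mk⇔; Equivalence)
open import Level using (0ℓ)
open import Relation.Binary using (Rel; DecidableEquality; tri<; tri≈; tri>)
open import Relation.Binary.PropositionalEquality using (_≡_; _≢_; refl; sym; trans; cong; cong₂; subst; subst₂; setoid; module ≡-Reasoning)
open import Relation.Binary.Construct.Closure.ReflexiveTransitive using (ε)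
open import Relation.Nullary using (yes; no; ¬_; ¬?)
open import Relation.Unary using (Pred; Decidable)

Before⇒∈ʳ : ∀ {L a b} → Before L a b → b ∈ L
Before⇒∈ʳ (Before.here q)  = there q
Before⇒∈ʳ (Before.there p) = there (Before⇒∈ʳ p)

Before-asym : ∀ {L a b} → Unique L → Before L a b → ¬ Before L b a
Before-asym (x∉ ∷ _) (Before.here q)  (Before.here r)  = All.lookup x∉ q refl
Before-asym (x∉ ∷ _) (Before.here q)  (Before.there r) = All.lookup x∉ (Before⇒∈ʳ r) refl
Before-asym (x∉ ∷ _) (Before.there p) (Before.here r)  = All.lookup x∉ (Before⇒∈ʳ p) refl
Before-asym (_ ∷ u)  (Before.there p) (Before.there r) = Before-asym u p r

Before-irrefl : ∀ {L a} → Unique L → ¬ Before L a a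
Before-irrefl u p = Before-asym u p p

Before-total : ∀ {L a b} → a ∈ L → b ∈ L → a ≢ b → Before L a b ⊎ Before L b a
Before-total (here refl) (here refl) a≢b = ⊥-elim (a≢b refl)
Before-total (here refl) (there q)   _   = inj₁ (Before.here q)
Before-total (there p)   (here refl) _   = inj₂ (Before.here p)
Before-total (there p)   (there q)   a≢b with Before-total p q a≢b
... | inj₁ r = inj₁ (Before.there r)
... | inj₂ r = inj₂ (Before.there r)

Before-AllPairs : ∀ {R : Rel ℕ 0ℓ} {L a b} → AllPairs R L → Before L a b → R a b
Before-AllPairs (Ra ∷ _) (Before.here q)  = All.lookup Ra q
Before-AllPairs (_ ∷ r)  (Before.there p) = Before-AllPairs r p

Before-swapAdjacent : ∀ pre {x y post c d} → (c , d) ≢ (x , y) →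
  Before (pre ++ x ∷ y ∷ post) c d → Before (pre ++ y ∷ x ∷ post) c d
Before-swapAdjacent []  ne (Before.here (here refl))       = ⊥-elim (ne refl)
Before-swapAdjacent []  _  (Before.here (there r))         = Before.there (Before.here r)
Before-swapAdjacent []  _  (Before.there (Before.here q))  = Before.here (there q)
Before-swapAdjacent []  _  (Before.there (Before.there p)) = Before.there (Before.there p)
Before-swapAdjacent (_ ∷ pre) {x} {y} _ (Before.here q) = Before.here (∈-resp-↭ (++⁺ˡ pre (swap x y refl)) q)
Before-swapAdjacent (_ ∷ pre) ne (Before.there p) = Before.there (Before-swapAdjacent pre ne p)

Unique-resp-↭ : {xs ys : List ℕ} → xs ↭ ys → Unique xs → Unique ys
Unique-resp-↭ p = ↭ₛ.Unique-resp-↭ (setoid ℕ) (↭⇒↭ₛ p)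

module _ {A : Set} {P Q : Pred A 0ℓ} (P? : Decidable P) (Q? : Decidable Q) where

  length-filter-mono : ∀ xs → (∀ {x} → x ∈ xs → Q x → P x) →
    length (filter Q? xs) ≤ length (filter P? xs)
  length-filter-mono []       _   = z≤n
  length-filter-mono (x ∷ xs) Q⇒P with Q? x | P? x
  ... | yes Qx | yes _  = s≤s (length-filter-mono xs (Q⇒P ∘ there))
  ... | yes Qx | no ¬Px = ⊥-elim (¬Px (Q⇒P (here refl) Qx))
  ... | no _   | yes _  = m≤n⇒m≤1+n (length-filter-mono xs (Q⇒P ∘ there))
  ... | no _   | no _   = length-filter-mono xs (Q⇒P ∘ there)

  length-filter-complement : ∀ xs → (∀ {x} → x ∈ xs → P x ⊎ Q x) → (∀ {x} → x ∈ xs → ¬ (P x × Q x)) →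
    length (filter P? xs) + length (filter Q? xs) ≡ length xs
  length-filter-complement []       _      _       = refl
  length-filter-complement (x ∷ xs) P⊎Q ¬P×Q with P? x | Q? x | P⊎Q (here refl)
  ... | yes Px | yes Qx | _      = ⊥-elim (¬P×Q (here refl) (Px , Qx))
  ... | yes _  | no _   | _      = cong suc (length-filter-complement xs (P⊎Q ∘ there) (¬P×Q ∘ there))
  ... | no _   | yes _  | _      = trans (+-suc _ _) (cong suc (length-filter-complement xs (P⊎Q ∘ there) (¬P×Q ∘ there)))
  ... | no ¬Px | no _   | inj₁ Px = ⊥-elim (¬Px Px)
  ... | no _   | no ¬Qx | inj₂ Qx = ⊥-elim (¬Qx Qx)

  module _ (e : A) (Q⇒P : ∀ {x} → x ≢ e → Q x → P x) where

    length-filter-≤-suc : DecidableEquality A → ∀ xs → Unique xs →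
      length (filter Q? xs) ≤ suc (length (filter P? xs))
    length-filter-≤-suc _≟ₐ_ []       _ = z≤n
    length-filter-≤-suc _≟ₐ_ (x ∷ xs) (x∉ ∷ u) with x ≟ₐ e
    ... | yes refl = head-case (length-filter-mono xs (λ y∈xs → Q⇒P (λ { refl → All.lookup x∉ y∈xs refl })))
      where
        head-case : length (filter Q? xs) ≤ length (filter P? xs) →
                    length (filter Q? (x ∷ xs)) ≤ suc (length (filter P? (x ∷ xs)))
        head-case le with Q? x | P? x
        ... | yes _ | yes _ = s≤s (m≤n⇒m≤1+n le)
        ... | yes _ | no _  = s≤s le
        ... | no _  | yes _ = m≤n⇒m≤1+n (m≤n⇒m≤1+n le)
        ... | no _  | no _  = m≤n⇒m≤1+n le
    ... | no x≢e with Q? x | P? x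
    ...   | yes _  | yes _  = s≤s (length-filter-≤-suc _≟ₐ_ xs u)
    ...   | yes Qx | no ¬Px = ⊥-elim (¬Px (Q⇒P x≢e Qx))
    ...   | no _   | yes _  = m≤n⇒m≤1+n (length-filter-≤-suc _≟ₐ_ xs u)
    ...   | no _   | no _   = length-filter-≤-suc _≟ₐ_ xs u

    length-filter-< : ∀ xs → Unique xs → e ∈ xs → P e → ¬ Q e →
      length (filter Q? xs) < length (filter P? xs)
    length-filter-< (x ∷ xs) (x∉ ∷ u) (here refl) Pe ¬Qe with Q? x | P? x
    ... | yes Qe | _      = ⊥-elim (¬Qe Qe)
    ... | no _   | no ¬Pe = ⊥-elim (¬Pe Pe)
    ... | no _   | yes _  = s≤s (length-filter-mono xs (λ y∈xs → Q⇒P (λ { refl → All.lookup x∉ y∈xs refl })))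
    length-filter-< (x ∷ xs) (x∉ ∷ u) (there e∈xs) Pe ¬Qe with Q? x | P? x
    ... | yes _  | yes _  = s≤s (length-filter-< xs u e∈xs Pe ¬Qe)
    ... | yes Qx | no ¬Px = ⊥-elim (¬Px (Q⇒P (λ { refl → All.lookup x∉ e∈xs refl }) Qx))
    ... | no _   | yes _  = m≤n⇒m≤1+n (length-filter-< xs u e∈xs Pe ¬Qe)
    ... | no _   | no _   = length-filter-< xs u e∈xs Pe ¬Qe

swapAt-↭ : ∀ k L → swapAt k L ↭ L
swapAt-↭ zero          L           = refl
swapAt-↭ (suc zero)    []          = refl
swapAt-↭ (suc zero)    (x ∷ [])    = refl
swapAt-↭ (suc zero)    (x ∷ y ∷ L) = swap y x refl
swapAt-↭ (suc (suc k)) []          = refl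
swapAt-↭ (suc (suc k)) (x ∷ L)     = prep x (swapAt-↭ (suc k) L)

data AdjacentSwap : List ℕ → List ℕ → Set where
  adjacentSwap : ∀ pre p q post → AdjacentSwap (pre ++ p ∷ q ∷ post) (pre ++ q ∷ p ∷ post)

adjacentSwap-∷ : ∀ z {L L′} → AdjacentSwap L L′ → AdjacentSwap (z ∷ L) (z ∷ L′)
adjacentSwap-∷ z (adjacentSwap pre p q post) = adjacentSwap (z ∷ pre) p q post

swapAt-adjacentSwap : ∀ k L → 1 ≤ k → k < length L → AdjacentSwap L (swapAt k L)
swapAt-adjacentSwap (suc zero)    (p ∷ q ∷ post) _ _          = adjacentSwap [] p q post
swapAt-adjacentSwap (suc zero)    (_ ∷ [])       _ (s≤s ())
swapAt-adjacentSwap (suc (suc k)) (z ∷ L)        _ (s≤s k<∣L∣) =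
  adjacentSwap-∷ z (swapAt-adjacentSwap (suc k) L (s≤s z≤n) k<∣L∣)

foldl-swapAt-↭ : ∀ u ws → foldl (flip swapAt) u ws ↭ u
foldl-swapAt-↭ u []       = refl
foldl-swapAt-↭ u (x ∷ ws) = ↭-trans (foldl-swapAt-↭ (swapAt x u) ws) (swapAt-↭ x u)

foldl-swapAt-take-suc : ∀ u ws {m} → m < length ws → ∃ λ x → x ∈ ws ×
  foldl (flip swapAt) u (take (suc m) ws) ≡ swapAt x (foldl (flip swapAt) u (take m ws))
foldl-swapAt-take-suc u (y ∷ ws) {zero}  _ = y , here refl , refl
foldl-swapAt-take-suc u (y ∷ ws) {suc m} (s≤s m<∣ws∣)
  with x , x∈ws , eq ← foldl-swapAt-take-suc (swapAt y u) ws m<∣ws∣ = x , there x∈ws , eq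

idPerm-unique : ∀ n → Unique (idPerm n)
idPerm-unique n = Unique.map⁺ suc-injective (Unique.upTo⁺ n)

idPerm-increasing : ∀ n → AllPairs _<_ (idPerm n)
idPerm-increasing n = AllPairs.map⁺ (AllPairs.applyUpTo⁺₁ (λ k → k) n (λ i<j _ → s≤s i<j))

∈-idPerm⁺ : ∀ {n a} → 1 ≤ a → a ≤ n → a ∈ idPerm n
∈-idPerm⁺ {a = suc a} _ a<n = ∈-map⁺ suc (∈-upTo⁺ a<n)

pairs-unique : ∀ n → Unique (cartesianProduct (idPerm n) (idPerm n))
pairs-unique n = Unique.cartesianProduct⁺ (idPerm-unique n) (idPerm-unique n)

Inv-idPerm : ∀ n → Inv n (idPerm n) ≡ []
Inv-idPerm n = filter-none _ {xs = cartesianProduct (idPerm n) (idPerm n)}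
  (All.tabulate λ {(a , b)} _ (a<b , b≺a) → <-asym a<b (Before-AllPairs (idPerm-increasing n) b≺a))

IsInversion : List ℕ → ℕ × ℕ → Set
IsInversion w (a , b) = a < b × Before w b a

Inv-adjacentSwap-≤ : ∀ n {L L′} → AdjacentSwap L L′ → length (Inv n L′) ≤ suc (length (Inv n L))
Inv-adjacentSwap-≤ n (adjacentSwap pre p q post) =
  length-filter-≤-suc _ _ (p , q) inversion-kept (Product.≡-dec _≟_ _≟_)
    (cartesianProduct (idPerm n) (idPerm n)) (pairs-unique n)
  where
    inversion-kept : ∀ {x} → x ≢ (p , q) →
      IsInversion (pre ++ q ∷ p ∷ post) x → IsInversion (pre ++ p ∷ q ∷ post) x
    inversion-kept ne (a<b , b≺a) = a<b , Before-swapAdjacent pre (λ { refl → ne refl }) b≺a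

Inv-adjacentSwap-< : ∀ n {L L′ c d} → AdjacentSwap L L′ → Unique L′ → c < d → c ∈ idPerm n → d ∈ idPerm n →
  Before L d c → Before L′ c d → length (Inv n L′) < length (Inv n L)
Inv-adjacentSwap-< n {c = c} {d} (adjacentSwap pre p q post) unique c<d c∈ d∈ d≺c c≺d
  with Product.≡-dec _≟_ _≟_ (d , c) (p , q)
... | no ne    = ⊥-elim (Before-asym unique (Before-swapAdjacent pre ne d≺c) c≺d)
... | yes refl =
  length-filter-< _ _ (c , d) inversion-kept
    (cartesianProduct (idPerm n) (idPerm n)) (pairs-unique n) (∈-cartesianProduct⁺ c∈ d∈)
    (c<d , d≺c) (λ (_ , d≺c′) → Before-asym unique d≺c′ c≺d)
  where
    inversion-kept : ∀ {x} → x ≢ (c , d) →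
      IsInversion (pre ++ c ∷ d ∷ post) x → IsInversion (pre ++ d ∷ c ∷ post) x
    inversion-kept ne (a<b , b≺a) = a<b , Before-swapAdjacent pre (λ { refl → <-asym a<b c<d }) b≺a

∈-insertions⁻ : ∀ x p {q} → q ∈ insertions x p → q ↭ x ∷ p
∈-insertions⁻ x []       (here refl) = refl
∈-insertions⁻ x (y ∷ ys) (here refl) = refl
∈-insertions⁻ x (y ∷ ys) (there q∈)
  with q′ , q′∈ , refl ← ∈-map⁻ (y ∷_) q∈ = ↭-trans (prep y (∈-insertions⁻ x ys q′∈)) (swap y x refl)

∈-insertions⁺ : ∀ x ys zs → ys ++ x ∷ zs ∈ insertions x (ys ++ zs)
∈-insertions⁺ x []       []      = here refl
∈-insertions⁺ x []       (_ ∷ _) = here refl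
∈-insertions⁺ x (y ∷ ys) zs      = there (∈-map⁺ (y ∷_) (∈-insertions⁺ x ys zs))

∈-perms⁻ : ∀ xs {q} → q ∈ perms xs → q ↭ xs
∈-perms⁻ []       (here refl) = refl
∈-perms⁻ (x ∷ xs) q∈
  with p , p∈ , q∈′ ← find (∈-concatMap⁻ (insertions x) {xs = perms xs} q∈) =
  ↭-trans (∈-insertions⁻ x p q∈′) (prep x (∈-perms⁻ xs p∈))

∈-perms⁺ : ∀ xs {q} → q ↭ xs → q ∈ perms xs
∈-perms⁺ []       q↭[] with refl ← ↭-empty-inv q↭[] = here refl
∈-perms⁺ (x ∷ xs) q↭
  with ys , zs , refl ← ∈-∃++ (∈-resp-↭ (↭-sym q↭) (here refl)) =
  ∈-concatMap⁺ (insertions x)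
    (lose (∈-perms⁺ xs (drop-∷ (↭-trans (↭-sym (shift x ys zs)) q↭))) (∈-insertions⁺ x ys zs))

deleteFirst : ℕ → List ℕ → List ℕ
deleteFirst x []       = []
deleteFirst x (y ∷ ys) with x ≟ y
... | yes _ = ys
... | no _  = y ∷ deleteFirst x ys

deleteFirst-insertions : ∀ x p {q} → x ∉ p → q ∈ insertions x p → deleteFirst x q ≡ p
deleteFirst-insertions x []      _ (here refl) with x ≟ x
... | yes _  = refl
... | no x≢x = ⊥-elim (x≢x refl)
deleteFirst-insertions x (_ ∷ _) _ (here refl) with x ≟ x
... | yes _  = refl
... | no x≢x = ⊥-elim (x≢x refl)
deleteFirst-insertions x (y ∷ ys) x∉p (there q∈)
  with q′ , q′∈ , refl ← ∈-map⁻ (y ∷_) q∈ with x ≟ y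
... | yes refl = ⊥-elim (x∉p (here refl))
... | no _     = cong (y ∷_) (deleteFirst-insertions x ys (x∉p ∘ there) q′∈)

insertions-unique : ∀ x p → x ∉ p → Unique (insertions x p)
insertions-unique x []       _   = [] ∷ []
insertions-unique x (y ∷ ys) x∉p =
  All.tabulate head-new ∷ Unique.map⁺ ∷-injectiveʳ (insertions-unique x ys (x∉p ∘ there))
  where
    head-new : ∀ {v} → v ∈ map (y ∷_) (insertions x ys) → x ∷ y ∷ ys ≢ v
    head-new v∈ refl with _ , _ , eq ← ∈-map⁻ (y ∷_) v∈ = x∉p (here (∷-injectiveˡ eq))

concatMap-insertions-unique : ∀ x ps → All.All (x ∉_) ps → Unique ps → Unique (concatMap (insertions x) ps)
concatMap-insertions-unique x []       _            _          = []
concatMap-insertions-unique x (p ∷ ps) (x∉p ∷ x∉ps) (p∉ps ∷ u) =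
  Unique.++⁺ (insertions-unique x p x∉p) (concatMap-insertions-unique x ps x∉ps u) disjoint
  where
    disjoint : ∀ {v} → ¬ (v ∈ insertions x p × v ∈ concatMap (insertions x) ps)
    disjoint (v∈ , v∈′) with p′ , p′∈ , v∈″ ← find (∈-concatMap⁻ (insertions x) {xs = ps} v∈′) =
      All.lookup p∉ps p′∈ (trans (sym (deleteFirst-insertions x p x∉p v∈))
                                 (deleteFirst-insertions x p′ (All.lookup x∉ps p′∈) v∈″))

perms-unique : ∀ xs → Unique xs → Unique (perms xs)
perms-unique []       _          = [] ∷ []
perms-unique (x ∷ xs) (x∉xs ∷ u) = concatMap-insertions-unique x (perms xs)
  (All.tabulate λ p∈ x∈p → All.lookup x∉xs (∈-resp-↭ (∈-perms⁻ xs p∈) x∈p) refl)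
  (perms-unique xs u)

sum-map-const : ∀ {A : Set} (ρ : A → ℕ) {c} xs → (∀ {x} → x ∈ xs → ρ x ≡ c) → sum (map ρ xs) ≡ length xs * c
sum-map-const ρ []       _     = refl
sum-map-const ρ (x ∷ xs) ρ≡c = cong₂ _+_ (ρ≡c (here refl)) (sum-map-const ρ xs (ρ≡c ∘ there))

module _ {A : Set} (_≟ₐ_ : DecidableEquality A) (ρ : A → ℕ) {S xs : List A}
         (S-unique : Unique S) (xs-unique : Unique xs) (xs⊆S : ∀ {x} → x ∈ xs → x ∈ S)
         (ρ≡1 : ∀ {x} → x ∈ xs → ρ x ≡ 1) (ρ≡0 : ∀ {x} → x ∈ S → x ∉ xs → ρ x ≡ 0) where

  private
    open import Data.List.Membership.DecPropositional _≟ₐ_ using (_∈?_)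

    outside : List A
    outside = filter (λ x → ¬? (x ∈? xs)) S

    S↭xs++outside : S ↭ xs ++ outside
    S↭xs++outside = ∼bag⇒↭ (unique∧set⇒bag S-unique xs++outside-unique (mk⇔ to from))
      where
        xs++outside-unique : Unique (xs ++ outside)
        xs++outside-unique = Unique.++⁺ xs-unique (Unique.filter⁺ _ S-unique)
          (λ (x∈xs , x∈out) → proj₂ (∈-filter⁻ _ {xs = S} x∈out) x∈xs)
        to : ∀ {x} → x ∈ S → x ∈ xs ++ outside
        to {x} x∈S with x ∈? xs
        ... | yes x∈xs = ∈-++⁺ˡ x∈xs
        ... | no x∉xs  = ∈-++⁺ʳ xs (∈-filter⁺ _ x∈S x∉xs)
        from : ∀ {x} → x ∈ xs ++ outside → x ∈ S
        from x∈ with ∈-++⁻ xs x∈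
        ... | inj₁ x∈xs  = xs⊆S x∈xs
        ... | inj₂ x∈out = proj₁ (∈-filter⁻ _ {xs = S} x∈out)

  sum-indicator-filter : ∀ {P : Pred A 0ℓ} (P? : Decidable P) →
    sum (map ρ (filter P? S)) ≡ length (filter P? xs)
  sum-indicator-filter P? = begin
    sum (map ρ (filter P? S))
      ≡⟨ sum-↭ (↭.map⁺ ρ (↭.filter-↭ P? S↭xs++outside)) ⟩
    sum (map ρ (filter P? (xs ++ outside)))
      ≡⟨ cong (sum ∘ map ρ) (filter-++ P? xs outside) ⟩
    sum (map ρ (filter P? xs ++ filter P? outside))
      ≡⟨ cong sum (map-++ ρ (filter P? xs) (filter P? outside)) ⟩
    sum (map ρ (filter P? xs) ++ map ρ (filter P? outside))
      ≡⟨ sum-++ (map ρ (filter P? xs)) (map ρ (filter P? outside)) ⟩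
    sum (map ρ (filter P? xs)) + sum (map ρ (filter P? outside))
      ≡⟨ cong₂ _+_ (sum-map-const ρ _ (ρ≡1 ∘ filtered xs)) (sum-map-const ρ _ (ρ≡0′ ∘ filtered outside)) ⟩
    length (filter P? xs) * 1 + length (filter P? outside) * 0
      ≡⟨ cong₂ _+_ (*-identityʳ _) (*-zeroʳ (length (filter P? outside))) ⟩
    length (filter P? xs) + 0
      ≡⟨ +-identityʳ _ ⟩
    length (filter P? xs) ∎
    where
      open ≡-Reasoning
      filtered : ∀ ys {x} → x ∈ filter P? ys → x ∈ ys
      filtered ys = proj₁ ∘ ∈-filter⁻ P? {xs = ys}
      ρ≡0′ : ∀ {x} → x ∈ outside → ρ x ≡ 0
      ρ≡0′ x∈out = let x∈S , x∉xs = ∈-filter⁻ _ {xs = S} x∈out in ρ≡0 x∈S x∉xs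

m+m≤n⇔m≤⌊n/2⌋ : ∀ m n → m + m ≤ n ⇔ m ≤ ⌊ n /2⌋
m+m≤n⇔m≤⌊n/2⌋ m n = mk⇔
  (λ m+m≤n → ≤-trans (≤-reflexive (n≡⌊n+n/2⌋ m)) (⌊n/2⌋-mono m+m≤n))
  (λ m≤⌊n/2⌋ → ≤-trans (+-mono-≤ m≤⌊n/2⌋ (≤-trans m≤⌊n/2⌋ (⌊n/2⌋≤⌈n/2⌉ n))) (≤-reflexive (⌊n/2⌋+⌈n/2⌉≡n n)))

module _ {ℓ A B : ℕ} (A+B≡1+ℓ : A + B ≡ suc ℓ) where

  minority<majority⇔≤⌊ℓ/2⌋ : B < A ⇔ B ≤ ⌊ ℓ /2⌋
  minority<majority⇔≤⌊ℓ/2⌋ = mk⇔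
    (λ B<A → Equivalence.to (m+m≤n⇔m≤⌊n/2⌋ B ℓ) (≤-pred (subst (B + B <_) B+A≡1+ℓ (+-monoʳ-< B B<A))))
    (λ B≤⌊ℓ/2⌋ → +-cancelˡ-< B B A (subst (B + B <_) (sym B+A≡1+ℓ) (s≤s (Equivalence.from (m+m≤n⇔m≤⌊n/2⌋ B ℓ) B≤⌊ℓ/2⌋))))
    where
      B+A≡1+ℓ : B + A ≡ suc ℓ
      B+A≡1+ℓ = trans (+-comm B A) A+B≡1+ℓ

  minority<majority⇔⌈ℓ/2⌉< : B < A ⇔ ⌈ ℓ /2⌉ < A
  minority<majority⇔⌈ℓ/2⌉< = mk⇔
    (λ B<A → ≰⇒> λ A≤⌈ℓ/2⌉ → <⇒≱ (subst (_< A + A) A+B≡1+ℓ (+-monoʳ-< A B<A))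
                                      (Equivalence.from (m+m≤n⇔m≤⌊n/2⌋ A (suc ℓ)) A≤⌈ℓ/2⌉))
    (λ ⌈ℓ/2⌉<A → +-cancelˡ-< A B A (subst (_< A + A) (sym A+B≡1+ℓ)
                   (≰⇒> λ A+A≤1+ℓ → <⇒≱ ⌈ℓ/2⌉<A (Equivalence.to (m+m≤n⇔m≤⌊n/2⌋ A (suc ℓ)) A+A≤1+ℓ))))

DownClosedBelow : {A : Set} → (ℕ → A) → Pred A 0ℓ → ℕ → Set
DownClosedBelow f P N = ∀ {j k} → j ≤ k → k < N → P (f k) → P (f j)

stepDown⇒downClosed : ∀ {A : Set} (f : ℕ → A) {P : Pred A 0ℓ} {N} →
  (∀ {m} → suc m < N → P (f (suc m)) → P (f m)) → DownClosedBelow f P N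
stepDown⇒downClosed f         step {k = zero}  z≤n    _      Pfk = Pfk
stepDown⇒downClosed f {P = P} step {k = suc k} j≤1+k 1+k<N Pfk with m≤n⇒m<n∨m≡n j≤1+k
... | inj₂ refl  = Pfk
... | inj₁ j<1+k = stepDown⇒downClosed f {P = P} step (≤-pred j<1+k) (<⇒≤ 1+k<N) (step 1+k<N Pfk)

module _ {A : Set} (f : ℕ → A) {P : Pred A 0ℓ} (P? : Decidable P) where

  countBelow : ℕ → ℕ
  countBelow N = length (filter P? (applyDownFrom f N))

  countBelow≤ : ∀ N → countBelow N ≤ N
  countBelow≤ N = subst (countBelow N ≤_) (length-applyDownFrom f N) (length-filter P? (applyDownFrom f N))

  downClosed⇒P⇔<countBelow : ∀ {N} → DownClosedBelow f P N → ∀ {m} → m < N → P (f m) ⇔ m < countBelow N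
  downClosed⇒P⇔<countBelow {suc N} closed {m} m<1+N with P? (f N)
  ... | yes PfN = mk⇔ (λ _ → s≤s (≤-trans (≤-pred m<1+N) (N≤countBelow N closed PfN)))
                      (λ _ → closed (≤-pred m<1+N) ≤-refl PfN)
    where
      N≤countBelow : ∀ K → DownClosedBelow f P (suc K) → P (f K) → K ≤ countBelow K
      N≤countBelow zero    _      _   = z≤n
      N≤countBelow (suc K) closed PfK = Equivalence.to
        (downClosed⇒P⇔<countBelow (λ j≤k k<K → closed j≤k (m≤n⇒m≤1+n k<K)) ≤-refl)
        (closed (n≤1+n K) ≤-refl PfK)
  ... | no ¬PfN with m≤n⇒m<n∨m≡n (≤-pred m<1+N)
  ...   | inj₁ m<N = downClosed⇒P⇔<countBelow (λ j≤k k<N → closed j≤k (m≤n⇒m≤1+n k<N)) m<N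
  ...   | inj₂ refl = mk⇔ (⊥-elim ∘ ¬PfN) (⊥-elim ∘ ≤⇒≯ (countBelow≤ N))

module _ {A : Set} (f : ℕ → A) {P Q : Pred A 0ℓ} (P? : Decidable P) (Q? : Decidable Q) where

  countBelow-complement : ∀ N → (∀ {m} → m < N → P (f m) ⊎ Q (f m)) → (∀ {m} → m < N → ¬ (P (f m) × Q (f m))) →
    countBelow f P? N + countBelow f Q? N ≡ N
  countBelow-complement N P⊎Q ¬P×Q =
    trans (length-filter-complement P? Q? (applyDownFrom f N) (onList P⊎Q) (onList ¬P×Q)) (length-applyDownFrom f N)
    where
      onList : ∀ {R : Pred A 0ℓ} → (∀ {m} → m < N → R (f m)) → ∀ {x} → x ∈ applyDownFrom f N → R x
      onList R-below x∈ with _ , m<N , refl ← ∈-applyDownFrom⁻ f x∈ = R-below m<N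

  module _ (ℓ : ℕ) (P⊎Q : ∀ {m} → m ≤ ℓ → P (f m) ⊎ Q (f m)) (¬P×Q : ∀ {m} → m ≤ ℓ → ¬ (P (f m) × Q (f m))) where

    private
      A+B≡1+ℓ : countBelow f P? (suc ℓ) + countBelow f Q? (suc ℓ) ≡ suc ℓ
      A+B≡1+ℓ = countBelow-complement (suc ℓ) (P⊎Q ∘ ≤-pred) (¬P×Q ∘ ≤-pred)

      ¬Q⇒P : ∀ {m} → m ≤ ℓ → ¬ Q (f m) → P (f m)
      ¬Q⇒P m≤ℓ ¬Qm with P⊎Q m≤ℓ
      ... | inj₁ Pm = Pm
      ... | inj₂ Qm = ⊥-elim (¬Qm Qm)

    countBelow-majority : DownClosedBelow f P (suc ℓ) ⊎ DownClosedBelow f Q (suc ℓ) →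
      countBelow f Q? (suc ℓ) < countBelow f P? (suc ℓ) ⇔ (P (f ⌊ ℓ /2⌋) × P (f ⌈ ℓ /2⌉))
    countBelow-majority (inj₁ P-closed) = mk⇔
      (λ B<A → let PH = Equivalence.from (P⇔<A (⌈n/2⌉≤n ℓ)) (Equivalence.to (minority<majority⇔⌈ℓ/2⌉< A+B≡1+ℓ) B<A)
               in P-closed (⌊n/2⌋≤⌈n/2⌉ ℓ) (s≤s (⌈n/2⌉≤n ℓ)) PH , PH)
      (λ (_ , PH) → Equivalence.from (minority<majority⇔⌈ℓ/2⌉< A+B≡1+ℓ) (Equivalence.to (P⇔<A (⌈n/2⌉≤n ℓ)) PH))
      where
        P⇔<A : ∀ {m} → m ≤ ℓ → P (f m) ⇔ m < countBelow f P? (suc ℓ)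
        P⇔<A m≤ℓ = downClosed⇒P⇔<countBelow f P? P-closed (s≤s m≤ℓ)
    countBelow-majority (inj₂ Q-closed) = mk⇔
      (λ B<A → let ¬Qh = ≤⇒≯ (Equivalence.to (minority<majority⇔≤⌊ℓ/2⌋ A+B≡1+ℓ) B<A) ∘ Equivalence.to (Q⇔<B (⌊n/2⌋≤n ℓ))
               in ¬Q⇒P (⌊n/2⌋≤n ℓ) ¬Qh , ¬Q⇒P (⌈n/2⌉≤n ℓ) (¬Qh ∘ Q-closed (⌊n/2⌋≤⌈n/2⌉ ℓ) (s≤s (⌈n/2⌉≤n ℓ))))
      (λ (Ph , _) → Equivalence.from (minority<majority⇔≤⌊ℓ/2⌋ A+B≡1+ℓ)
                      (≮⇒≥ λ h<B → ¬P×Q (⌊n/2⌋≤n ℓ) (Ph , Equivalence.from (Q⇔<B (⌊n/2⌋≤n ℓ)) h<B)))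
      where
        Q⇔<B : ∀ {m} → m ≤ ℓ → Q (f m) ⇔ m < countBelow f Q? (suc ℓ)
        Q⇔<B m≤ℓ = downClosed⇒P⇔<countBelow f Q? Q-closed (s≤s m≤ℓ)

unitSteps⇒identity : ∀ (g : ℕ → ℕ) ℓ → g 0 ≡ 0 → g ℓ ≡ ℓ → (∀ {m} → m < ℓ → g (suc m) ≤ suc (g m)) →
  ∀ {m} → m ≤ ℓ → g m ≡ m
unitSteps⇒identity g ℓ g0≡0 gℓ≡ℓ step {m} m≤ℓ = ≤-antisym (upper m≤ℓ) (lower (ℓ ∸ m) (m∸n+n≡m m≤ℓ))
  where
    upper : ∀ {m} → m ≤ ℓ → g m ≤ m
    upper {zero}  _   = ≤-reflexive g0≡0
    upper {suc m} m<ℓ = ≤-trans (step m<ℓ) (s≤s (upper (<⇒≤ m<ℓ)))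
    lower : ∀ d {m} → d + m ≡ ℓ → m ≤ g m
    lower zero    refl = ≤-reflexive (sym gℓ≡ℓ)
    lower (suc d) {m} 1+d+m≡ℓ =
      ≤-pred (≤-trans (lower d (trans (+-suc d m) 1+d+m≡ℓ)) (step (subst (m <_) 1+d+m≡ℓ (s≤s (m≤n+m m d)))))

module ReducedWordPrefixes (n : ℕ) (i : List ℕ) (i-isWord : IsWord n i)
                           (i-reduced : length i ≡ length (Inv n (prod n i))) where

  ℓ : ℕ
  ℓ = length i

  prefix : ℕ → List ℕ
  prefix m = prod n (take m i)

  prefix-↭ : ∀ m → prefix m ↭ idPerm n
  prefix-↭ m = foldl-swapAt-↭ (idPerm n) (take m i)

  prefix-unique : ∀ m → Unique (prefix m)
  prefix-unique m = Unique-resp-↭ (↭-sym (prefix-↭ m)) (idPerm-unique n)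

  ∈-prefix : ∀ m {c} → c ∈ idPerm n → c ∈ prefix m
  ∈-prefix m = ∈-resp-↭ (↭-sym (prefix-↭ m))

  length-prefix : ∀ m → length (prefix m) ≡ n
  length-prefix m = trans (↭-length (prefix-↭ m)) (trans (length-map suc (upTo n)) (length-upTo n))

  prefix-adjacentSwap : ∀ {m} → m < ℓ → AdjacentSwap (prefix m) (prefix (suc m))
  prefix-adjacentSwap {m} m<ℓ with x , x∈i , prefix[1+m]≡ ← foldl-swapAt-take-suc (idPerm n) i m<ℓ =
    let 1≤x , x<n = i-isWord x x∈i in
    subst (AdjacentSwap (prefix m)) (sym prefix[1+m]≡)
      (swapAt-adjacentSwap x (prefix m) 1≤x (subst (x <_) (sym (length-prefix m)) x<n))

  Inv-prefix : ∀ {m} → m ≤ ℓ → length (Inv n (prefix m)) ≡ m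
  Inv-prefix = unitSteps⇒identity (λ m → length (Inv n (prefix m))) ℓ
    (cong length (Inv-idPerm n))
    (trans (cong (length ∘ Inv n ∘ prod n) (take-all ℓ i ≤-refl)) (sym i-reduced))
    (Inv-adjacentSwap-≤ n ∘ prefix-adjacentSwap)

  Before-prefix-pred : ∀ {c d m} → c < d → c ∈ idPerm n → d ∈ idPerm n → m < ℓ →
    Before (prefix (suc m)) c d → Before (prefix m) c d
  Before-prefix-pred {c} {d} {m} c<d c∈ d∈ m<ℓ c≺d
    with Before-total (∈-prefix m c∈) (∈-prefix m d∈) (<⇒≢ c<d)
  ... | inj₁ c≺d′ = c≺d′
  -- Otherwise the step from prefix m to prefix (suc m) removes the inversion (c , d),
  -- lowering the inversion number, which grows by one at each step.
  ... | inj₂ d≺c  = ⊥-elim (<⇒≱ (subst₂ _<_ (Inv-prefix m<ℓ) (Inv-prefix (<⇒≤ m<ℓ)) Inv-decreases) (n≤1+n m))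
    where
      Inv-decreases : length (Inv n (prefix (suc m))) < length (Inv n (prefix m))
      Inv-decreases = Inv-adjacentSwap-< n (prefix-adjacentSwap m<ℓ) (prefix-unique (suc m)) c<d c∈ d∈ d≺c c≺d

  Before-prefix-downClosed : ∀ {c d} → c < d → c ∈ idPerm n → d ∈ idPerm n →
    DownClosedBelow prefix (λ L → Before L c d) (suc ℓ)
  Before-prefix-downClosed c<d c∈ d∈ =
    stepDown⇒downClosed prefix {P = λ L → Before L _ _} (Before-prefix-pred c<d c∈ d∈ ∘ ≤-pred)

  prefixes : List (List ℕ)
  prefixes = applyDownFrom prefix (suc ℓ)

  prefixes-unique : Unique prefixes
  prefixes-unique = Unique.applyDownFrom⁺₁ prefix (suc ℓ) λ {j} {k} k<j j<1+ℓ prefix[j]≡prefix[k] →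
    <⇒≢ k<j (begin
      k                         ≡⟨ Inv-prefix (≤-trans (<⇒≤ k<j) (≤-pred j<1+ℓ)) ⟨
      length (Inv n (prefix k)) ≡⟨ cong (length ∘ Inv n) prefix[j]≡prefix[k] ⟨
      length (Inv n (prefix j)) ≡⟨ Inv-prefix (≤-pred j<1+ℓ) ⟩
      j                         ∎)
    where open ≡-Reasoning

  prefix-majority : ∀ {a b} → a ∈ idPerm n → b ∈ idPerm n →
    countBelow prefix (λ L → before? L b a) (suc ℓ) < countBelow prefix (λ L → before? L a b) (suc ℓ)
      ⇔ (Before (prefix ⌊ ℓ /2⌋) a b × Before (prefix ⌈ ℓ /2⌉) a b)
  prefix-majority {a} {b} a∈ b∈ with a ≟ b
  ... | yes refl = mk⇔ (⊥-elim ∘ <-irrefl refl) (⊥-elim ∘ Before-irrefl (prefix-unique ⌊ ℓ /2⌋) ∘ proj₁)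
  ... | no a≢b   = countBelow-majority prefix (λ L → before? L a b) (λ L → before? L b a) ℓ
    (λ {m} _ → Before-total (∈-prefix m a∈) (∈-prefix m b∈) a≢b)
    (λ {m} _ (a≺b , b≺a) → Before-asym (prefix-unique m) a≺b b≺a)
    downClosed
    where
      downClosed : DownClosedBelow prefix (λ L → Before L a b) (suc ℓ) ⊎ DownClosedBelow prefix (λ L → Before L b a) (suc ℓ)
      downClosed with <-cmp a b
      ... | tri< a<b _ _ = inj₁ (Before-prefix-downClosed a<b a∈ b∈)
      ... | tri≈ _ a≡b _ = ⊥-elim (a≢b a≡b)
      ... | tri> _ _ b<a = inj₂ (Before-prefix-downClosed b<a b∈ a∈)

  module _ (class-trivial : ∀ j → InClass i j → j ≡ i) (ρ : List ℕ → ℕ) (tally : IsUniformTally n i ρ) where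

    InPre⇒∈prefixes : ∀ {L} → InPre n i L → L ∈ prefixes
    InPre⇒∈prefixes (j , i→j , m , m≤ℓ , prefix[m]≡L) with refl ← class-trivial j i→j =
      subst (_∈ prefixes) prefix[m]≡L (∈-applyDownFrom⁺ prefix (s≤s m≤ℓ))

    support≡countBelow : ∀ c d → support n ρ c d ≡ countBelow prefix (λ L → before? L c d) (suc ℓ)
    support≡countBelow c d = sum-indicator-filter (≡-dec _≟_) ρ
      (perms-unique (idPerm n) (idPerm-unique n)) prefixes-unique prefix∈Sym ρ≡1 ρ≡0 (λ L → before? L c d)
      where
        prefix∈Sym : ∀ {L} → L ∈ prefixes → L ∈ Sym n
        prefix∈Sym L∈ with m , _ , refl ← ∈-applyDownFrom⁻ prefix L∈ = ∈-perms⁺ (idPerm n) (prefix-↭ m)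
        ρ≡1 : ∀ {L} → L ∈ prefixes → ρ L ≡ 1
        ρ≡1 L∈ with m , m<1+ℓ , refl ← ∈-applyDownFrom⁻ prefix L∈ =
          proj₁ (tally (prefix m) (prefix-↭ m)) (i , ε , m , ≤-pred m<1+ℓ , refl)
        ρ≡0 : ∀ {L} → L ∈ Sym n → L ∉ prefixes → ρ L ≡ 0
        ρ≡0 L∈Sym L∉ = proj₂ (tally _ (∈-perms⁻ (idPerm n) L∈Sym)) (L∉ ∘ InPre⇒∈prefixes)

proposition4p1 : (n : ℕ) (w i : List ℕ) → IsPerm n w → IsReducedWord n w i →
    (∀ j → InClass i j → j ≡ i) →
    (ρ : List ℕ → ℕ) → IsUniformTally n i ρ →
    ∀ a b → 1 ≤ a → a ≤ n → 1 ≤ b → b ≤ n →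
    Majority n ρ a b ⇔
      (Before (prod n (take ⌊ length i /2⌋ i)) a b × Before (prod n (take ⌈ length i /2⌉ i)) a b)
proposition4p1 n _ i _ (i-isWord , refl , i-reduced) class-trivial ρ tally a b 1≤a a≤n 1≤b b≤n =
  subst₂ (λ B A → B < A ⇔ _) (sym (support≡countBelow class-trivial ρ tally b a))
                              (sym (support≡countBelow class-trivial ρ tally a b))
    (prefix-majority (∈-idPerm⁺ 1≤a a≤n) (∈-idPerm⁺ 1≤b b≤n))
  where open ReducedWordPrefixes n i i-isWord i-reduced
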